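{- Let $G$ be a finite simple undirected graph, let $d\ge 1$ be an integer, and let $U=\{v_1,v_2,v_3,v_4\}\subseteq V(G)$ consist of four distinct vertices with $d_G(v_1)=d_G(v_2)=d$ and $d_G(v_3)=d_G(v_4)=d+2$. If $U$ contains a balanceable set (a $3$-element subset of $U$ that is balanceable in $G$), then there is a set $D\subseteq V(G)$ with $|D|\le 3$ such that the induced subgraph $G[V(G)\setminus D]$ contains at least three vertices that have the same degree in $G[V(G)\setminus D]$.
   Context: $d_G(v)$ denotes the degree of $v$ in $G$, and $G[S]$ the subgraph induced by $S$. A set $S=\{x,y,z\}$ of three distinct vertices of $G$, labeled so that $d_G(x)\le d_G(y)\le d_G(z)$, is called balanceable if one of the following holds: (C1) $G[S]$ has no edges; (C2) $G[S]$ is a triangle; (C3) the only edge of $G[S]$ is $xy$; (C4) the edges of $G[S]$ are exactly $xy$ and $xz$. (When degrees tie, $S$ is balanceable if some labeling with $d_G(x)\le d_G(y)\le d_G(z)$ satisfies one of these conditions.) -}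

module Defs where

open import Data.Nat using (ℕ; _≤_)
open import Data.Bool using (Bool; true; false)
open import Data.Fin using (Fin)
open import Data.Fin.Subset using (Subset; ∣_∣; _∩_; ∁; _∉_)
open import Data.Vec using (tabulate)
open import Data.Product using (_×_; ∃-syntax; Σ-syntax)
open import Data.Sum using (_⊎_)
open import Relation.Binary.PropositionalEquality using (_≡_; _≢_)

record Graph (n : ℕ) : Set where
  field
    adj     : Fin n → Fin n → Bool
    symm    : ∀ u v → adj u v ≡ adj v u
    irrefl  : ∀ v → adj v v ≡ false
open Graph public

module _ {n : ℕ} (G : Graph n) where

  Edge : Fin n → Fin n → Set
  Edge u v = adj G u v ≡ true

  NonEdge : Fin n → Fin n → Set
  NonEdge u v = adj G u v ≡ false

  nbhd : Fin n → Subset n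
  nbhd u = tabulate (adj G u)

  deg : Fin n → ℕ
  deg u = ∣ nbhd u ∣

  degDel : Subset n → Fin n → ℕ
  degDel D u = ∣ nbhd u ∩ ∁ D ∣

  BalancedLabeling : Fin n → Fin n → Fin n → Set
  BalancedLabeling x y z =
    deg x ≤ deg y × deg y ≤ deg z ×
    (  (NonEdge x y × NonEdge x z × NonEdge y z)
     ⊎ (Edge x y × Edge x z × Edge y z)
     ⊎ (Edge x y × NonEdge x z × NonEdge y z)
     ⊎ (Edge x y × Edge x z × NonEdge y z))

  Balanceable : Fin n → Fin n → Fin n → Set
  Balanceable x y z =
    x ≢ y × x ≢ z × y ≢ z ×
    (  BalancedLabeling x y z ⊎ BalancedLabeling x z y
     ⊎ BalancedLabeling y x z ⊎ BalancedLabeling y z x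
     ⊎ BalancedLabeling z x y ⊎ BalancedLabeling z y x)

_∈₄_ : {n : ℕ} → Fin n → (Fin n × Fin n × Fin n × Fin n) → Set
w ∈₄ (a Data.Product., b Data.Product., c Data.Product., d) = w ≡ a ⊎ w ≡ b ⊎ w ≡ c ⊎ w ≡ d

module Submission where

-- Let U = {v₁, v₂, v₃, v₄}, with v₁, v₂ low (degree d) and v₃, v₄ high (degree d + 2), and call
-- the excess of a vertex the number of its high neighbours in U minus its low ones. Summed over all
-- vertices the excess is deg v₃ + deg v₄ − deg v₁ − deg v₂ = 4, and only five adjacency rows to U
-- have positive excess; so, up to the contribution of U itself, vertices outside U with these rows
-- carry excess at least 4. Deleting a few of them, possibly together with the fourth vertex of U,
-- brings the degrees of a triple of U to a common value. Two outside vertices with the same row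
-- always do so, hence otherwise every row occurs at most once, and the claim becomes a finite one
-- about the 2⁶ graphs on U and the 2⁵ sets of occurring rows, which is decided by evaluation.

open import Defs

import Data.Nat.Properties as ℕ
open import Algebra.Properties.Semiring.Sum ℕ.+-*-semiring
  using (sum-syntax; sum-cong-≗; sum-replicate-zero; ∑-distrib-+; ∑-comm; *-distribˡ-sum; *-distribʳ-sum)
open import Data.Bool using (Bool; true; false; T; T?; not; _∧_)
open import Data.Bool.ListAction using (any)
import Data.Bool.Properties as Bool
open import Data.Empty using (⊥-elim)
open import Data.Fin using (Fin; zero; suc)
open import Data.Fin.Patterns using (0F; 1F; 2F; 3F; 4F)
open import Data.Fin.Properties using (_≟_; suc-injective; ¬∀⟶∃¬) renaming (any? to ∃-fin?; all? to ∀-fin?)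
open import Data.Fin.Subset using (Subset; ∣_∣; _∩_; ∁; _∉_)
open import Data.List using (List; []; _∷_; length; map; concatMap; _++_; filterᵇ)
open import Data.List.Properties using (map-cong; map-cong-local; map-∘; length-map)
open import Data.List.Relation.Unary.All as All using (All; []; _∷_)
import Data.List.Relation.Unary.All.Properties as All
open import Data.List.Relation.Unary.AllPairs using ([]; _∷_; allPairs?)
open import Data.List.Relation.Unary.Any using (Any; any?; satisfied)
open import Data.List.Relation.Unary.Unique.Propositional using (Unique)
open import Data.Nat using (ℕ; zero; suc; _+_; _*_; _∸_; _≤_; _≤?_; z≤n; s≤s)
open import Data.Nat.Properties
  using (+-identityʳ; +-assoc; +-comm; +-cancelʳ-≡; +-cancelˡ-≤; +-mono-≤; +-monoˡ-≤; *-monoʳ-≤; *-identityʳ;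
         m≤n+m∸n; ≤-reflexive; ≤-trans; module ≤-Reasoning)
open import Data.Nat.ListAction using (sum)
open import Data.Nat.Tactic.RingSolver using (solve-∀)
open import Data.Product using (_×_; _,_; proj₁; proj₂; ∃-syntax; Σ-syntax)
open import Data.Sum using (_⊎_; inj₁; inj₂)
open import Data.Unit using (⊤; tt)
open import Data.Vec using (Vec; []; _∷_; lookup; tabulate)
open import Data.Vec.Properties using (lookup∘tabulate; tabulate-cong; []=⇒lookup; ≡-dec)
open import Function using (_∘_)
open import Relation.Binary.PropositionalEquality
  using (_≡_; _≢_; ≢-sym; refl; sym; trans; cong; cong₂; subst; subst₂; module ≡-Reasoning)
open import Relation.Nullary using (Dec; yes; no; does; ¬?)
open import Relation.Nullary.Decidable using (_×-dec_; _→-dec_; map′; dec-true; dec-false; toWitness; decidable-stable)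
open import Relation.Unary using (Decidable)

private
  variable
    n : ℕ

toℕ : Bool → ℕ
toℕ false = 0
toℕ true  = 1

∣tabulate∣≡∑ : (f : Fin n → Bool) → ∣ tabulate f ∣ ≡ ∑[ v < n ] toℕ (f v)
∣tabulate∣≡∑ {zero}  f = refl
∣tabulate∣≡∑ {suc n} f with f zero
... | true  = cong suc (∣tabulate∣≡∑ (f ∘ suc))
... | false = ∣tabulate∣≡∑ (f ∘ suc)

∑-select : (a : Fin n) (g : Fin n → ℕ) → ∑[ v < n ] (toℕ (does (v ≟ a)) * g v) ≡ g a
∑-select {suc n} zero    g = trans (cong₂ _+_ (+-identityʳ (g zero)) (sum-replicate-zero n)) (+-identityʳ (g zero))
∑-select {suc n} (suc a) g = ∑-select a (g ∘ suc)

∑-mono-≤ : {f g : Fin n → ℕ} → (∀ v → f v ≤ g v) → ∑[ v < n ] f v ≤ ∑[ v < n ] g v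
∑-mono-≤ {zero}  _   = z≤n
∑-mono-≤ {suc n} f≤g = +-mono-≤ (f≤g zero) (∑-mono-≤ (f≤g ∘ suc))

some-or-none : (f : Fin n → Bool) → (∃[ v ] T (f v)) ⊎ ∑[ v < n ] toℕ (f v) ≡ 0
some-or-none {zero}  f = inj₂ refl
some-or-none {suc n} f with f zero in f0 | some-or-none (f ∘ suc)
... | true  | _             = inj₁ (zero , subst T (sym f0) tt)
... | false | inj₁ (v , fv) = inj₁ (suc v , fv)
... | false | inj₂ none     = inj₂ none

two-or-at-most-one : (f : Fin n → Bool) →
                     (∃[ p ] ∃[ q ] p ≢ q × T (f p) × T (f q)) ⊎ ∑[ v < n ] toℕ (f v) ≤ 1
two-or-at-most-one {zero}  f = inj₂ z≤n
two-or-at-most-one {suc n} f with f zero in f0 | some-or-none (f ∘ suc) | two-or-at-most-one (f ∘ suc)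
... | true  | inj₁ (q , fq) | _ = inj₁ (zero , suc q , (λ ()) , subst T (sym f0) tt , fq)
... | true  | inj₂ none     | _ = inj₂ (≤-reflexive (cong suc none))
... | false | _ | inj₁ (p , q , p≢q , fp , fq) = inj₁ (suc p , suc q , p≢q ∘ suc-injective , fp , fq)
... | false | _ | inj₂ ≤1                      = inj₂ ≤1

∀⊎⇒⊎∀ : ∀ {m} {A : Set} {B : Fin m → Set} → (∀ k → A ⊎ B k) → A ⊎ (∀ k → B k)
∀⊎⇒⊎∀ {zero}  f = inj₂ λ ()
∀⊎⇒⊎∀ {suc m} f with f zero | ∀⊎⇒⊎∀ (f ∘ suc)
... | inj₁ a | _       = inj₁ a
... | inj₂ _ | inj₁ a  = inj₁ a
... | inj₂ b | inj₂ bs = inj₂ λ { zero → b ; (suc k) → bs k }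

∀-vec? : ∀ m {P : Vec Bool m → Set} → Decidable P → Dec (∀ v → P v)
∀-vec? zero    P? = map′ (λ { p [] → p }) (λ p → p []) (P? [])
∀-vec? (suc m) P? = map′ (λ { (p , q) (true ∷ v) → p v ; (p , q) (false ∷ v) → q v })
                         (λ p → p ∘ (true ∷_) , p ∘ (false ∷_))
                         (∀-vec? m (P? ∘ (true ∷_)) ×-dec ∀-vec? m (P? ∘ (false ∷_)))

toℕ-split : ∀ a b → toℕ a ≡ toℕ (a ∧ not b) + toℕ (b ∧ a)
toℕ-split true  true  = refl
toℕ-split true  false = refl
toℕ-split false true  = refl
toℕ-split false false = refl

∩∁-tabulate : (f g : Fin n → Bool) → tabulate f ∩ ∁ (tabulate g) ≡ tabulate (λ v → f v ∧ not (g v))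
∩∁-tabulate {zero}  f g = refl
∩∁-tabulate {suc n} f g = cong (f zero ∧ not (g zero) ∷_) (∩∁-tabulate (f ∘ suc) (g ∘ suc))

_∈ᵇ_ : Fin n → List (Fin n) → Bool
v ∈ᵇ ds = any (λ s → does (v ≟ s)) ds

setOf : List (Fin n) → Subset n
setOf ds = tabulate (_∈ᵇ ds)

∈ᵇ-false : {v : Fin n} {ds : List (Fin n)} → All (v ≢_) ds → v ∈ᵇ ds ≡ false
∈ᵇ-false []                             = refl
∈ᵇ-false {v = v} (_∷_ {x = s} v≢s v∉ds) rewrite dec-false (v ≟ s) v≢s = ∈ᵇ-false v∉ds

∉setOf : {v : Fin n} {ds : List (Fin n)} → All (v ≢_) ds → v ∉ setOf ds
∉setOf {v = v} {ds} v∉ds v∈ds with trans (sym (lookup∘tabulate (_∈ᵇ ds) v)) ([]=⇒lookup v∈ds)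
... | v∈ᵇds rewrite ∈ᵇ-false v∉ds with v∈ᵇds
... | ()

∑-∈ᵇ : (f : Fin n → Bool) {ds : List (Fin n)} → Unique ds →
       ∑[ v < n ] toℕ (v ∈ᵇ ds ∧ f v) ≡ sum (map (toℕ ∘ f) ds)
∑-∈ᵇ {n} f {[]}     []            = sum-replicate-zero n
∑-∈ᵇ {n} f {s ∷ ds} (s∉ds ∷ uniq) = begin
  ∑[ v < n ] toℕ (v ∈ᵇ (s ∷ ds) ∧ f v)
    ≡⟨ sum-cong-≗ split ⟩
  ∑[ v < n ] (toℕ (does (v ≟ s)) * toℕ (f v) + toℕ (v ∈ᵇ ds ∧ f v))
    ≡⟨ ∑-distrib-+ (λ v → toℕ (does (v ≟ s)) * toℕ (f v)) (λ v → toℕ (v ∈ᵇ ds ∧ f v)) ⟩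
  ∑[ v < n ] (toℕ (does (v ≟ s)) * toℕ (f v)) + ∑[ v < n ] toℕ (v ∈ᵇ ds ∧ f v)
    ≡⟨ cong₂ _+_ (∑-select s (toℕ ∘ f)) (∑-∈ᵇ f uniq) ⟩
  toℕ (f s) + sum (map (toℕ ∘ f) ds) ∎
  where
  open ≡-Reasoning
  split : ∀ v → toℕ (v ∈ᵇ (s ∷ ds) ∧ f v) ≡ toℕ (does (v ≟ s)) * toℕ (f v) + toℕ (v ∈ᵇ ds ∧ f v)
  split v with v ≟ s
  ... | no _                              = refl
  ... | yes refl rewrite ∈ᵇ-false s∉ds = sym (trans (+-identityʳ _) (+-identityʳ _))

sum-map-1 : {A : Set} (xs : List A) → sum (map (λ _ → 1) xs) ≡ length xs
sum-map-1 []       = refl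
sum-map-1 (_ ∷ xs) = cong suc (sum-map-1 xs)

∣setOf∣ : {ds : List (Fin n)} → Unique ds → ∣ setOf ds ∣ ≡ length ds
∣setOf∣ {n} {ds} uniq = begin
  ∣ setOf ds ∣                    ≡⟨ ∣tabulate∣≡∑ (_∈ᵇ ds) ⟩
  ∑[ v < n ] toℕ (v ∈ᵇ ds)        ≡⟨ sum-cong-≗ (λ v → cong toℕ (sym (Bool.∧-identityʳ (v ∈ᵇ ds)))) ⟩
  ∑[ v < n ] toℕ (v ∈ᵇ ds ∧ true) ≡⟨ ∑-∈ᵇ (λ _ → true) uniq ⟩
  sum (map (λ _ → 1) ds)          ≡⟨ sum-map-1 ds ⟩
  length ds                       ∎
  where open ≡-Reasoning

EqualDegreeTriple : Graph n → Subset n → Set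
EqualDegreeTriple G D = ∃[ a ] ∃[ b ] ∃[ c ] a ∉ D × b ∉ D × c ∉ D × a ≢ b × a ≢ c × b ≢ c
  × degDel G D a ≡ degDel G D b × degDel G D a ≡ degDel G D c

EqualDegreeTripleAfterDeleting≤3 : Graph n → Set
EqualDegreeTripleAfterDeleting≤3 {n} G = Σ[ D ∈ Subset n ] ∣ D ∣ ≤ 3 × EqualDegreeTriple G D

cancel-crosswise : ∀ x y p q → x + p + q ≡ y + q + p → x ≡ y
cancel-crosswise x y p q eq = +-cancelʳ-≡ (p + q) x y (begin
  x + (p + q) ≡⟨ +-assoc x p q ⟨
  x + p + q   ≡⟨ eq ⟩
  y + q + p   ≡⟨ +-assoc y q p ⟩
  y + (q + p) ≡⟨ cong (y +_) (+-comm q p) ⟩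
  y + (p + q) ∎)
  where open ≡-Reasoning

module _ (G : Graph n) where

  neighboursIn : Fin n → List (Fin n) → ℕ
  neighboursIn u ds = sum (map (toℕ ∘ adj G u) ds)

  deg≡∑ : ∀ u → deg G u ≡ ∑[ v < n ] toℕ (adj G u v)
  deg≡∑ u = ∣tabulate∣≡∑ (adj G u)

  deg≡degDel+neighboursIn : {ds : List (Fin n)} → Unique ds → ∀ u →
                            deg G u ≡ degDel G (setOf ds) u + neighboursIn u ds
  deg≡degDel+neighboursIn {ds} uniq u = begin
    deg G u
      ≡⟨ deg≡∑ u ⟩
    ∑[ v < n ] toℕ (adj G u v)
      ≡⟨ sum-cong-≗ (λ v → toℕ-split (adj G u v) (v ∈ᵇ ds)) ⟩
    ∑[ v < n ] (toℕ (adj G u v ∧ not (v ∈ᵇ ds)) + toℕ (v ∈ᵇ ds ∧ adj G u v))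
      ≡⟨ ∑-distrib-+ (λ v → toℕ (adj G u v ∧ not (v ∈ᵇ ds))) (λ v → toℕ (v ∈ᵇ ds ∧ adj G u v)) ⟩
    ∑[ v < n ] toℕ (adj G u v ∧ not (v ∈ᵇ ds)) + ∑[ v < n ] toℕ (v ∈ᵇ ds ∧ adj G u v)
      ≡⟨ cong₂ _+_ (sym degDel≡∑) (∑-∈ᵇ (adj G u) uniq) ⟩
    degDel G (setOf ds) u + neighboursIn u ds ∎
    where
    open ≡-Reasoning
    degDel≡∑ : degDel G (setOf ds) u ≡ ∑[ v < n ] toℕ (adj G u v ∧ not (v ∈ᵇ ds))
    degDel≡∑ = trans (cong ∣_∣ (∩∁-tabulate (adj G u) (_∈ᵇ ds))) (∣tabulate∣≡∑ (λ v → adj G u v ∧ not (v ∈ᵇ ds)))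

  -- The balance hypotheses say deg a − |N(a) ∩ ds| = deg b − |N(b) ∩ ds| etc., without subtraction.
  deleting-equalizes : ∀ {a b c} → a ≢ b → a ≢ c → b ≢ c →
    (ds : List (Fin n)) → Unique ds → length ds ≤ 3 → All (λ s → a ≢ s × b ≢ s × c ≢ s) ds →
    deg G a + neighboursIn b ds ≡ deg G b + neighboursIn a ds →
    deg G a + neighboursIn c ds ≡ deg G c + neighboursIn a ds →
    EqualDegreeTripleAfterDeleting≤3 G
  deleting-equalizes {a} {b} {c} a≢b a≢c b≢c ds uniq len avoids a~b a~c =
    setOf ds , subst (_≤ 3) (sym (∣setOf∣ uniq)) len ,
    a , b , c , ∉setOf (All.map proj₁ avoids) , ∉setOf (All.map (proj₁ ∘ proj₂) avoids) ,
    ∉setOf (All.map (proj₂ ∘ proj₂) avoids) , a≢b , a≢c , b≢c , equal a~b , equal a~c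
    where
    equal : ∀ {x y} → deg G x + neighboursIn y ds ≡ deg G y + neighboursIn x ds →
            degDel G (setOf ds) x ≡ degDel G (setOf ds) y
    equal {x} {y} x~y = cancel-crosswise _ _ (neighboursIn x ds) (neighboursIn y ds)
      (subst₂ (λ dx dy → dx + neighboursIn y ds ≡ dy + neighboursIn x ds)
              (deg≡degDel+neighboursIn uniq x) (deg≡degDel+neighboursIn uniq y) x~y)

-- Index i : Fin 4 stands for v₍ᵢ₊₁₎, of degree d + offset i; a Row is the adjacency of a vertex to v₁ … v₄.

offset : Fin 4 → ℕ
offset 0F = 0
offset 1F = 0
offset 2F = 2
offset 3F = 2

Row : Set
Row = Vec Bool 4

Edges : Set
Edges = Vec Bool 6

adjacency : Edges → Fin 4 → Fin 4 → Bool
adjacency (e₀₁ ∷ e₀₂ ∷ e₀₃ ∷ e₁₂ ∷ e₁₃ ∷ e₂₃ ∷ []) = table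
  where
  table : Fin 4 → Fin 4 → Bool
  table 0F 0F = false
  table 0F 1F = e₀₁
  table 0F 2F = e₀₂
  table 0F 3F = e₀₃
  table 1F 0F = e₀₁
  table 1F 1F = false
  table 1F 2F = e₁₂
  table 1F 3F = e₁₃
  table 2F 0F = e₀₂
  table 2F 1F = e₁₂
  table 2F 2F = false
  table 2F 3F = e₂₃
  table 3F 0F = e₀₃
  table 3F 1F = e₁₃
  table 3F 2F = e₂₃
  table 3F 3F = false

low high excess : Row → ℕ
low r    = toℕ (lookup r 0F) + toℕ (lookup r 1F)
high r   = toℕ (lookup r 2F) + toℕ (lookup r 3F)
excess r = high r ∸ low r

-- Exactly the rows of positive excess.
surplusRow : Fin 5 → Row
surplusRow 0F = false ∷ false ∷ true  ∷ true  ∷ []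
surplusRow 1F = false ∷ false ∷ true  ∷ false ∷ []
surplusRow 2F = false ∷ false ∷ false ∷ true  ∷ []
surplusRow 3F = true  ∷ false ∷ true  ∷ true  ∷ []
surplusRow 4F = false ∷ true  ∷ true  ∷ true  ∷ []

_≟ʳ_ : (r r′ : Row) → Dec (r ≡ r′)
_≟ʳ_ = ≡-dec Bool._≟_

opaque
  excess-decomposition : ∀ r → excess r ≡ ∑[ k < 5 ] (excess (surplusRow k) * toℕ (does (r ≟ʳ surplusRow k)))
  excess-decomposition = toWitness {a? = ∀-vec? 4 λ r → excess r ℕ.≟ _} tt

  surplusRow-injective : ∀ {k l} → surplusRow k ≡ surplusRow l → k ≡ l
  surplusRow-injective {k} {l} =
    toWitness {a? = ∀-fin? λ k → ∀-fin? λ l → surplusRow k ≟ʳ surplusRow l →-dec k ≟ l} tt k l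

high≤low+∑excess : ∀ r → high r ≤ low r + ∑[ k < 5 ] (excess (surplusRow k) * toℕ (does (r ≟ʳ surplusRow k)))
high≤low+∑excess r = ≤-trans (m≤n+m∸n (high r) (low r)) (≤-reflexive (cong (low r +_) (excess-decomposition r)))

-- inside i stands for v₍ᵢ₊₁₎, outside k for a vertex outside U with row surplusRow k.
data Symbol : Set where
  inside  : Fin 4 → Symbol
  outside : Fin 5 → Symbol

_≟ˢ_ : (s t : Symbol) → Dec (s ≡ t)
inside i  ≟ˢ inside j  = map′ (cong inside) (λ { refl → refl }) (i ≟ j)
outside k ≟ˢ outside l = map′ (cong outside) (λ { refl → refl }) (k ≟ l)
inside _  ≟ˢ outside _ = no λ ()
outside _ ≟ˢ inside _  = no λ ()

symbolRow : Edges → Symbol → Row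
symbolRow e (inside j)  = tabulate (λ i → adjacency e i j)
symbolRow e (outside k) = surplusRow k

Available : Vec Bool 5 → Symbol → Set
Available av (inside _)  = ⊤
Available av (outside k) = T (lookup av k)

available? : ∀ av s → Dec (Available av s)
available? av (inside _)  = yes tt
available? av (outside k) = T? (lookup av k)

Triple : Set
Triple = Fin 4 × Fin 4 × Fin 4

Distinct : Triple → Set
Distinct (i , j , k) = i ≢ j × i ≢ k × j ≢ k

distinct? : ∀ t → Dec (Distinct t)
distinct? (i , j , k) = ¬? (i ≟ j) ×-dec ¬? (i ≟ k) ×-dec ¬? (j ≟ k)

loss : List Row → Fin 4 → ℕ
loss rs i = sum (map (λ r → toℕ (lookup r i)) rs)

Balanced : Triple → List Row → Set
Balanced (i , j , k) rs = offset i + loss rs j ≡ offset j + loss rs i × offset i + loss rs k ≡ offset k + loss rs i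

balanced? : ∀ t rs → Dec (Balanced t rs)
balanced? (i , j , k) rs =
  offset i + loss rs j ℕ.≟ offset j + loss rs i ×-dec offset i + loss rs k ℕ.≟ offset k + loss rs i

Avoids : Triple → Symbol → Set
Avoids (i , j , k) s = s ≢ inside i × s ≢ inside j × s ≢ inside k

avoids? : ∀ t s → Dec (Avoids t s)
avoids? (i , j , k) s = ¬? (s ≟ˢ inside i) ×-dec ¬? (s ≟ˢ inside j) ×-dec ¬? (s ≟ˢ inside k)

record Move : Set where
  constructor _deleting_
  field
    triple  : Triple
    deleted : List Symbol

ValidMove : Edges → Vec Bool 5 → Move → Set
ValidMove e av (t deleting ss) = Distinct t × length ss ≤ 3 × Unique ss × All (Available av) ss ×
                                 All (Avoids t) ss × Balanced t (map (symbolRow e) ss)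

validMove? : ∀ e av m → Dec (ValidMove e av m)
validMove? e av (t deleting ss) =
  distinct? t ×-dec length ss ≤? 3 ×-dec allPairs? (λ s s′ → ¬? (s ≟ˢ s′)) ss ×-dec
  All.all? (available? av) ss ×-dec All.all? (avoids? t) ss ×-dec balanced? t (map (symbolRow e) ss)

choose≤ : {A : Set} → ℕ → List A → List (List A)
choose≤ zero    xs       = [] ∷ []
choose≤ (suc m) []       = [] ∷ []
choose≤ (suc m) (x ∷ xs) = map (x ∷_) (choose≤ m xs) ++ choose≤ (suc m) xs

moves : Vec Bool 5 → List Move
moves av = concatMap candidates ((0F , 1F , 2F , 3F) ∷ (0F , 1F , 3F , 2F) ∷ (0F , 2F , 3F , 1F) ∷ (1F , 2F , 3F , 0F) ∷ [])
  where
  candidates : Fin 4 × Triple → List Move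
  candidates (i , j , k , l) = map ((i , j , k) deleting_)
    (choose≤ 3 (inside l ∷ map outside (filterᵇ (lookup av) (0F ∷ 1F ∷ 2F ∷ 3F ∷ 4F ∷ []))))

data Pattern : Bool → Bool → Bool → Set where
  independent : Pattern false false false
  triangle    : Pattern true  true  true
  lowEdge     : Pattern true  false false
  cherry      : Pattern true  true  false

pattern? : ∀ a b c → Dec (Pattern a b c)
pattern? false false false = yes independent
pattern? true  true  true  = yes triangle
pattern? true  false false = yes lowEdge
pattern? true  true  false = yes cherry
pattern? false true  _     = no λ ()
pattern? false false true  = no λ ()
pattern? true  false true  = no λ ()

Pattern-cong : ∀ {a a′ b b′ c c′} → a ≡ a′ → b ≡ b′ → c ≡ c′ → Pattern a b c → Pattern a′ b′ c′
Pattern-cong refl refl refl p = p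

pattern-of : ∀ {a b c} →
  (a ≡ false × b ≡ false × c ≡ false) ⊎ (a ≡ true × b ≡ true × c ≡ true) ⊎
  (a ≡ true × b ≡ false × c ≡ false) ⊎ (a ≡ true × b ≡ true × c ≡ false) → Pattern a b c
pattern-of (inj₁ (refl , refl , refl))               = independent
pattern-of (inj₂ (inj₁ (refl , refl , refl)))        = triangle
pattern-of (inj₂ (inj₂ (inj₁ (refl , refl , refl)))) = lowEdge
pattern-of (inj₂ (inj₂ (inj₂ (refl , refl , refl)))) = cherry

Labeling : Edges → Triple → Set
Labeling e (i , j , k) = Distinct (i , j , k) × offset i ≤ offset j × offset j ≤ offset k ×
                         Pattern (adjacency e i j) (adjacency e i k) (adjacency e j k)

labeling? : ∀ e t → Dec (Labeling e t)
labeling? e (i , j , k) = distinct? (i , j , k) ×-dec offset i ≤? offset j ×-dec offset j ≤? offset k ×-dec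
                          pattern? (adjacency e i j) (adjacency e i k) (adjacency e j k)

Balanceable₄ : Edges → Set
Balanceable₄ e = ∃[ t ] Labeling e t

balanceable₄? : ∀ e → Dec (Balanceable₄ e)
balanceable₄? e = map′ (λ (i , j , k , l) → (i , j , k) , l) (λ ((i , j , k) , l) → i , j , k , l)
  (∃-fin? λ i → ∃-fin? λ j → ∃-fin? λ k → labeling? e (i , j , k))

SurplusBound : Edges → Vec Bool 5 → Set
SurplusBound e av = 4 + ∑[ j < 4 ] low (symbolRow e (inside j)) ≤
  ∑[ k < 5 ] (excess (surplusRow k) * toℕ (lookup av k)) + ∑[ j < 4 ] high (symbolRow e (inside j))

-- Opaque, so that the decision procedure is never unfolded at a configuration built from a graph.
opaque
  valid-move-exists : ∀ e → Balanceable₄ e → ∀ av → SurplusBound e av → Any (ValidMove e av) (moves av)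
  valid-move-exists = toWitness {a? = ∀-vec? 6 λ e → balanceable₄? e →-dec
    ∀-vec? 5 λ av → _ ≤? _ →-dec any? (validMove? e av) (moves av)} tt

-- The triple whose offsets are twice the entries of surplusRow k.
twinTriple : Fin 5 → Triple
twinTriple 0F = 0F , 1F , 2F
twinTriple 1F = 0F , 1F , 2F
twinTriple 2F = 0F , 1F , 3F
twinTriple 3F = 1F , 2F , 3F
twinTriple 4F = 0F , 2F , 3F

opaque
  twin-valid : ∀ k → Distinct (twinTriple k) × Balanced (twinTriple k) (surplusRow k ∷ surplusRow k ∷ [])
  twin-valid = toWitness {a? = ∀-fin? λ k → distinct? (twinTriple k) ×-dec
                                          balanced? (twinTriple k) (surplusRow k ∷ surplusRow k ∷ [])} tt

surplus-arith : ∀ d x y h l w → x + h ≡ d + 2 + (d + 2) → y + l ≡ d + 0 + (d + 0) → x ≤ y + w → 4 + l ≤ w + h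
surplus-arith d x y h l w x+h y+l x≤y+w = +-cancelˡ-≤ (d + d) (4 + l) (w + h) (begin
  d + d + (4 + l)           ≡⟨ shift₁ d l ⟩
  d + 2 + (d + 2) + l       ≡⟨ cong (_+ l) x+h ⟨
  x + h + l                 ≤⟨ +-monoˡ-≤ l (+-monoˡ-≤ h x≤y+w) ⟩
  y + w + h + l             ≡⟨ shift₂ y w h l ⟩
  y + l + (w + h)           ≡⟨ cong (_+ (w + h)) y+l ⟩
  d + 0 + (d + 0) + (w + h) ≡⟨ shift₃ d (w + h) ⟩
  d + d + (w + h)           ∎)
  where
  open ≤-Reasoning
  shift₁ : ∀ d l → d + d + (4 + l) ≡ d + 2 + (d + 2) + l
  shift₁ = solve-∀
  shift₂ : ∀ y w h l → y + w + h + l ≡ y + l + (w + h)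
  shift₂ = solve-∀
  shift₃ : ∀ d m → d + 0 + (d + 0) + m ≡ d + d + m
  shift₃ = solve-∀

module Quadruple (G : Graph n) (U : Fin 4 → Fin n) (U-injective : ∀ {i j} → U i ≡ U j → i ≡ j)
                 (d : ℕ) (deg-U : ∀ i → deg G (U i) ≡ d + offset i) where

  rowOf : Fin n → Row
  rowOf v = tabulate (λ i → adj G (U i) v)

  edges : Edges
  edges = adj G (U 0F) (U 1F) ∷ adj G (U 0F) (U 2F) ∷ adj G (U 0F) (U 3F) ∷
          adj G (U 1F) (U 2F) ∷ adj G (U 1F) (U 3F) ∷ adj G (U 2F) (U 3F) ∷ []

  adj-U : ∀ i j → adj G (U i) (U j) ≡ adjacency edges i j
  adj-U 0F 0F = irrefl G (U 0F)
  adj-U 0F 1F = refl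
  adj-U 0F 2F = refl
  adj-U 0F 3F = refl
  adj-U 1F 0F = symm G (U 1F) (U 0F)
  adj-U 1F 1F = irrefl G (U 1F)
  adj-U 1F 2F = refl
  adj-U 1F 3F = refl
  adj-U 2F 0F = symm G (U 2F) (U 0F)
  adj-U 2F 1F = symm G (U 2F) (U 1F)
  adj-U 2F 2F = irrefl G (U 2F)
  adj-U 2F 3F = refl
  adj-U 3F 0F = symm G (U 3F) (U 0F)
  adj-U 3F 1F = symm G (U 3F) (U 1F)
  adj-U 3F 2F = symm G (U 3F) (U 2F)
  adj-U 3F 3F = irrefl G (U 3F)

  rowOf-U : ∀ j → rowOf (U j) ≡ symbolRow edges (inside j)
  rowOf-U j = tabulate-cong (λ i → adj-U i j)

  neighboursIn-U : ∀ i ds → neighboursIn G (U i) ds ≡ loss (map rowOf ds) i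
  neighboursIn-U i ds = cong sum (trans (map-cong (λ v → cong toℕ (sym (lookup∘tabulate (λ i′ → adj G (U i′) v) i))) ds) (map-∘ ds))

  deleting-equalizes-U : ∀ {t} → Distinct t → let (i , j , k) = t in
    (ds : List (Fin n)) → Unique ds → length ds ≤ 3 → All (λ s → U i ≢ s × U j ≢ s × U k ≢ s) ds →
    Balanced t (map rowOf ds) → EqualDegreeTripleAfterDeleting≤3 G
  deleting-equalizes-U {i , j , k} (i≢j , i≢k , j≢k) ds uniq len avoids (i~j , i~k) =
    deleting-equalizes G (i≢j ∘ U-injective) (i≢k ∘ U-injective) (j≢k ∘ U-injective) ds uniq len avoids
      (balance i~j) (balance i~k)
    where
    balance : ∀ {x y} → offset x + loss (map rowOf ds) y ≡ offset y + loss (map rowOf ds) x →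
              deg G (U x) + neighboursIn G (U y) ds ≡ deg G (U y) + neighboursIn G (U x) ds
    balance {x} {y} x~y = begin
      deg G (U x) + neighboursIn G (U y) ds        ≡⟨ cong₂ _+_ (deg-U x) (neighboursIn-U y ds) ⟩
      d + offset x + loss (map rowOf ds) y         ≡⟨ +-assoc d _ _ ⟩
      d + (offset x + loss (map rowOf ds) y)       ≡⟨ cong (d +_) x~y ⟩
      d + (offset y + loss (map rowOf ds) x)       ≡⟨ +-assoc d _ _ ⟨
      d + offset y + loss (map rowOf ds) x         ≡⟨ cong₂ _+_ (deg-U y) (neighboursIn-U x ds) ⟨
      deg G (U y) + neighboursIn G (U x) ds        ∎
      where open ≡-Reasoning

  Outside : Fin n → Set
  Outside v = ∀ i → v ≢ U i

  record Witnesses : Set where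
    field
      available       : Vec Bool 5
      witness         : Fin 5 → Fin n
      witness-outside : ∀ {k} → T (lookup available k) → Outside (witness k)
      witness-row     : ∀ {k} → T (lookup available k) → rowOf (witness k) ≡ surplusRow k

  module Realization (W : Witnesses) where
    open Witnesses W

    ⟦_⟧ : Symbol → Fin n
    ⟦ inside i  ⟧ = U i
    ⟦ outside k ⟧ = witness k

    rowOf-⟦⟧ : ∀ {s} → Available available s → rowOf ⟦ s ⟧ ≡ symbolRow edges s
    rowOf-⟦⟧ {inside j}  _     = rowOf-U j
    rowOf-⟦⟧ {outside k} avail = witness-row avail

    ⟦⟧-injective : ∀ {s s′} → Available available s → Available available s′ → ⟦ s ⟧ ≡ ⟦ s′ ⟧ → s ≡ s′
    ⟦⟧-injective {inside i}  {inside j}  _ _ eq = cong inside (U-injective eq)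
    ⟦⟧-injective {inside i}  {outside l} _ b eq = ⊥-elim (witness-outside b i (sym eq))
    ⟦⟧-injective {outside k} {inside j}  a _ eq = ⊥-elim (witness-outside a j eq)
    ⟦⟧-injective {outside k} {outside l} a b eq =
      cong outside (surplusRow-injective (trans (sym (witness-row a)) (trans (cong rowOf eq) (witness-row b))))

    unique-⟦⟧ : ∀ {ss} → All (Available available) ss → Unique ss → Unique (map ⟦_⟧ ss)
    unique-⟦⟧ []           []              = []
    unique-⟦⟧ (a ∷ avails) (s∉ss ∷ uniq) =
      All.map⁺ (All.zipWith (λ (b , s≢s′) eq → s≢s′ (⟦⟧-injective a b eq)) (avails , s∉ss)) ∷ unique-⟦⟧ avails uniq

    realize : ∀ {m} → ValidMove edges available m → EqualDegreeTripleAfterDeleting≤3 G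
    realize {(i , j , k) deleting ss} (distinct , len , uniq , avails , avoids , balanced) =
      deleting-equalizes-U distinct (map ⟦_⟧ ss) (unique-⟦⟧ avails uniq) (subst (_≤ 3) (sym (length-map ⟦_⟧ ss)) len)
        (All.map⁺ (All.zipWith spares (avails , avoids)))
        (subst (Balanced (i , j , k)) (sym rows) balanced)
      where
      rows : map rowOf (map ⟦_⟧ ss) ≡ map (symbolRow edges) ss
      rows = trans (sym (map-∘ ss)) (map-cong-local (All.map (λ {s} → rowOf-⟦⟧ {s}) avails))
      spares : ∀ {s} → Available available s × Avoids (i , j , k) s → U i ≢ ⟦ s ⟧ × U j ≢ ⟦ s ⟧ × U k ≢ ⟦ s ⟧
      spares (a , s≢i , s≢j , s≢k) =
        (λ eq → s≢i (sym (⟦⟧-injective tt a eq))) ,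
        (λ eq → s≢j (sym (⟦⟧-injective tt a eq))) ,
        (λ eq → s≢k (sym (⟦⟧-injective tt a eq)))

  opaque
    outside? : ∀ v → Dec (Outside v)
    outside? v = ∀-fin? λ i → ¬? (v ≟ U i)

  inClass : Fin 5 → Fin n → Bool
  inClass k v = does (outside? v) ∧ does (rowOf v ≟ʳ surplusRow k)

  population : Fin 5 → ℕ
  population k = ∑[ v < n ] toℕ (inClass k v)

  does-≟-U : ∀ i j → does (U j ≟ U i) ≡ does (i ≟ j)
  does-≟-U i j with i ≟ j
  ... | yes refl = dec-true (U i ≟ U i) refl
  ... | no i≢j   = dec-false (U j ≟ U i) (λ eq → i≢j (sym (U-injective eq)))

  ∑-≟-U : ∀ v (o? : Dec (Outside v)) → ∑[ j < 4 ] toℕ (does (v ≟ U j)) ≡ toℕ (not (does o?))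
  ∑-≟-U v (yes out) = trans (sum-cong-≗ (λ j → cong toℕ (dec-false (v ≟ U j) (out j)))) (sum-replicate-zero 4)
  ∑-≟-U v (no ¬out) with ¬∀⟶∃¬ 4 _ (λ i → ¬? (v ≟ U i)) ¬out
  ...   | j , ¬v≢Uj with decidable-stable (v ≟ U j) ¬v≢Uj
  ...     | refl = trans (sum-cong-≗ (λ i → trans (cong toℕ (does-≟-U i j)) (sym (*-identityʳ _)))) (∑-select j (λ _ → 1))

  ∑-split-U : (g : Fin n → ℕ) →
              ∑[ v < n ] g v ≡ ∑[ v < n ] (toℕ (does (outside? v)) * g v) + ∑[ j < 4 ] g (U j)
  ∑-split-U g = begin
    ∑[ v < n ] g v
      ≡⟨ sum-cong-≗ pointwise ⟩
    ∑[ v < n ] (toℕ (does (outside? v)) * g v + ∑[ j < 4 ] (toℕ (does (v ≟ U j)) * g v))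
      ≡⟨ ∑-distrib-+ (λ v → toℕ (does (outside? v)) * g v) (λ v → ∑[ j < 4 ] (toℕ (does (v ≟ U j)) * g v)) ⟩
    ∑[ v < n ] (toℕ (does (outside? v)) * g v) + ∑[ v < n ] ∑[ j < 4 ] (toℕ (does (v ≟ U j)) * g v)
      ≡⟨ cong (∑[ v < n ] (toℕ (does (outside? v)) * g v) +_) (∑-comm (λ v j → toℕ (does (v ≟ U j)) * g v)) ⟩
    ∑[ v < n ] (toℕ (does (outside? v)) * g v) + ∑[ j < 4 ] ∑[ v < n ] (toℕ (does (v ≟ U j)) * g v)
      ≡⟨ cong (∑[ v < n ] (toℕ (does (outside? v)) * g v) +_) (sum-cong-≗ (λ j → ∑-select (U j) g)) ⟩
    ∑[ v < n ] (toℕ (does (outside? v)) * g v) + ∑[ j < 4 ] g (U j) ∎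
    where
    open ≡-Reasoning
    partition : ∀ b x → toℕ b * x + toℕ (not b) * x ≡ x
    partition true  x = trans (+-identityʳ (x + 0)) (+-identityʳ x)
    partition false x = +-identityʳ x
    pointwise : ∀ v → g v ≡ toℕ (does (outside? v)) * g v + ∑[ j < 4 ] (toℕ (does (v ≟ U j)) * g v)
    pointwise v = begin
      g v
        ≡⟨ partition (does (outside? v)) (g v) ⟨
      toℕ (does (outside? v)) * g v + toℕ (not (does (outside? v))) * g v
        ≡⟨ cong (λ m → toℕ (does (outside? v)) * g v + m * g v) (∑-≟-U v (outside? v)) ⟨
      toℕ (does (outside? v)) * g v + (∑[ j < 4 ] toℕ (does (v ≟ U j))) * g v
        ≡⟨ cong (toℕ (does (outside? v)) * g v +_) (*-distribʳ-sum (g v) (λ j → toℕ (does (v ≟ U j)))) ⟩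
      toℕ (does (outside? v)) * g v + ∑[ j < 4 ] (toℕ (does (v ≟ U j)) * g v) ∎

  surplus-bound : 4 + ∑[ j < 4 ] low (rowOf (U j)) ≤
                  ∑[ k < 5 ] (excess (surplusRow k) * population k) + ∑[ j < 4 ] high (rowOf (U j))
  surplus-bound = surplus-arith d (∑[ v < n ] (toℕ (does (outside? v)) * high (rowOf v)))
    (∑[ v < n ] (toℕ (does (outside? v)) * low (rowOf v))) (∑[ j < 4 ] high (rowOf (U j)))
    (∑[ j < 4 ] low (rowOf (U j))) (∑[ k < 5 ] (excess (surplusRow k) * population k))
    (trans (sym (∑-split-U (high ∘ rowOf))) (degrees 2F 3F))
    (trans (sym (∑-split-U (low ∘ rowOf))) (degrees 0F 1F))
    outside-bound
    where
    degrees : ∀ i j → ∑[ v < n ] (toℕ (adj G (U i) v) + toℕ (adj G (U j) v)) ≡ d + offset i + (d + offset j)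
    degrees i j = trans (∑-distrib-+ (λ v → toℕ (adj G (U i) v)) (λ v → toℕ (adj G (U j) v)))
      (cong₂ _+_ (trans (sym (deg≡∑ G (U i))) (deg-U i)) (trans (sym (deg≡∑ G (U j))) (deg-U j)))
    weighted : Fin n → Fin 5 → ℕ
    weighted v k = excess (surplusRow k) * toℕ (inClass k v)
    pointwise : ∀ v (o : Bool) → toℕ o * high (rowOf v) ≤
      toℕ o * low (rowOf v) + ∑[ k < 5 ] (excess (surplusRow k) * toℕ (o ∧ does (rowOf v ≟ʳ surplusRow k)))
    pointwise v false = z≤n
    pointwise v true  = subst₂ (λ h l → h ≤ l + ∑[ k < 5 ] (excess (surplusRow k) * toℕ (does (rowOf v ≟ʳ surplusRow k))))
      (sym (+-identityʳ (high (rowOf v)))) (sym (+-identityʳ (low (rowOf v)))) (high≤low+∑excess (rowOf v))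
    outside-bound : ∑[ v < n ] (toℕ (does (outside? v)) * high (rowOf v)) ≤
                    ∑[ v < n ] (toℕ (does (outside? v)) * low (rowOf v)) + ∑[ k < 5 ] (excess (surplusRow k) * population k)
    outside-bound = begin
      ∑[ v < n ] (toℕ (does (outside? v)) * high (rowOf v))
        ≤⟨ ∑-mono-≤ (λ v → pointwise v (does (outside? v))) ⟩
      ∑[ v < n ] (toℕ (does (outside? v)) * low (rowOf v) + ∑[ k < 5 ] weighted v k)
        ≡⟨ ∑-distrib-+ (λ v → toℕ (does (outside? v)) * low (rowOf v)) (λ v → ∑[ k < 5 ] weighted v k) ⟩
      ∑[ v < n ] (toℕ (does (outside? v)) * low (rowOf v)) + ∑[ v < n ] ∑[ k < 5 ] weighted v k
        ≡⟨ cong (∑[ v < n ] (toℕ (does (outside? v)) * low (rowOf v)) +_) (∑-comm weighted) ⟩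
      ∑[ v < n ] (toℕ (does (outside? v)) * low (rowOf v)) + ∑[ k < 5 ] ∑[ v < n ] weighted v k
        ≡⟨ cong (∑[ v < n ] (toℕ (does (outside? v)) * low (rowOf v)) +_)
                (sum-cong-≗ (λ k → sym (*-distribˡ-sum (excess (surplusRow k)) (λ v → toℕ (inClass k v))))) ⟩
      ∑[ v < n ] (toℕ (does (outside? v)) * low (rowOf v)) + ∑[ k < 5 ] (excess (surplusRow k) * population k) ∎
      where open ≤-Reasoning

  in-class : ∀ {k v} → T (inClass k v) → Outside v × rowOf v ≡ surplusRow k
  in-class {k} {v} v∈k with outside? v | rowOf v ≟ʳ surplusRow k
  ... | yes out | yes row = out , row

  avoided : ∀ {s} → Outside s → ∀ {i j k} → U i ≢ s × U j ≢ s × U k ≢ s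
  avoided out {i} {j} {k} = (λ eq → out i (sym eq)) , (λ eq → out j (sym eq)) , (λ eq → out k (sym eq))

  twin : ∀ {k p q} → p ≢ q → T (inClass k p) → T (inClass k q) → EqualDegreeTripleAfterDeleting≤3 G
  twin {k} {p} {q} p≢q p∈k q∈k with in-class {k} {p} p∈k | in-class {k} {q} q∈k | twin-valid k
  ... | p-out , p-row | q-out , q-row | distinct , balanced =
    deleting-equalizes-U distinct (p ∷ q ∷ []) ((p≢q ∷ []) ∷ [] ∷ []) (s≤s (s≤s z≤n)) (avoided p-out ∷ avoided q-out ∷ [])
      (subst (Balanced (twinTriple k)) (cong₂ (λ r r′ → r ∷ r′ ∷ []) (sym p-row) (sym q-row)) balanced)

  data Sparse (k : Fin 5) : Set where
    empty  : population k ≡ 0 → Sparse k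
    single : ∀ v → T (inClass k v) → population k ≤ 1 → Sparse k

  present : ∀ {k} → Sparse k → Bool
  present (empty _)      = false
  present (single _ _ _) = true

  pick : ∀ {k} → Sparse k → Fin n
  pick (empty _)      = U 0F   -- arbitrary: an empty class is never available
  pick (single v _ _) = v

  pick-in-class : ∀ {k} (c : Sparse k) → T (present c) → T (inClass k (pick c))
  pick-in-class (single _ v∈k _) _ = v∈k

  population≤present : ∀ {k} (c : Sparse k) → population k ≤ toℕ (present c)
  population≤present (empty none)       = ≤-reflexive none
  population≤present (single _ _ ≤1)    = ≤1

  twin-or-sparse : ∀ k → EqualDegreeTripleAfterDeleting≤3 G ⊎ Sparse k
  twin-or-sparse k with two-or-at-most-one (inClass k)
  ... | inj₁ (p , q , p≢q , p∈k , q∈k) = inj₁ (twin {k} p≢q p∈k q∈k)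
  ... | inj₂ ≤1 with some-or-none (inClass k)
  ...   | inj₁ (v , v∈k) = inj₂ (single v v∈k ≤1)
  ...   | inj₂ none      = inj₂ (empty none)

  module _ (sparse : ∀ k → Sparse k) where

    witnesses : Witnesses
    witnesses = record
      { available       = tabulate (present ∘ sparse)
      ; witness         = pick ∘ sparse
      ; witness-outside = λ {k} → proj₁ ∘ in-class {k} ∘ pick-in-class′
      ; witness-row     = λ {k} → proj₂ ∘ in-class {k} ∘ pick-in-class′
      }
      where
      pick-in-class′ : ∀ {k} → T (lookup (tabulate (present ∘ sparse)) k) → T (inClass k (pick (sparse k)))
      pick-in-class′ {k} = pick-in-class (sparse k) ∘ subst T (lookup∘tabulate (present ∘ sparse) k)

    sparse-surplus-bound : SurplusBound edges (Witnesses.available witnesses)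
    sparse-surplus-bound = begin
      4 + ∑[ j < 4 ] low (symbolRow edges (inside j))
        ≡⟨ cong (4 +_) (sum-cong-≗ (λ j → cong low (rowOf-U j))) ⟨
      4 + ∑[ j < 4 ] low (rowOf (U j))
        ≤⟨ surplus-bound ⟩
      ∑[ k < 5 ] (excess (surplusRow k) * population k) + ∑[ j < 4 ] high (rowOf (U j))
        ≤⟨ +-mono-≤ (∑-mono-≤ (λ k → *-monoʳ-≤ (excess (surplusRow k)) (population≤available k)))
                    (≤-reflexive (sum-cong-≗ (λ j → cong high (rowOf-U j)))) ⟩
      ∑[ k < 5 ] (excess (surplusRow k) * toℕ (lookup (tabulate (present ∘ sparse)) k)) +
        ∑[ j < 4 ] high (symbolRow edges (inside j)) ∎
      where
      open ≤-Reasoning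
      population≤available : ∀ k → population k ≤ toℕ (lookup (tabulate (present ∘ sparse)) k)
      population≤available k = subst (λ b → population k ≤ toℕ b) (sym (lookup∘tabulate (present ∘ sparse) k))
                                     (population≤present (sparse k))

  equal-degree-triple : Balanceable₄ edges → EqualDegreeTripleAfterDeleting≤3 G
  equal-degree-triple balanceable with ∀⊎⇒⊎∀ twin-or-sparse
  ... | inj₁ done   = done
  ... | inj₂ sparse = realize (proj₂ (satisfied (valid-move-exists edges balanceable available (sparse-surplus-bound sparse))))
    where
    open Witnesses (witnesses sparse) using (available)
    open Realization (witnesses sparse) using (realize)

  offset-mono : ∀ {i j} → deg G (U i) ≤ deg G (U j) → offset i ≤ offset j
  offset-mono {i} {j} le = +-cancelˡ-≤ d (offset i) (offset j) (subst₂ _≤_ (deg-U i) (deg-U j) le)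

  labeling-U : ∀ {i j k} → Distinct (i , j , k) → BalancedLabeling G (U i) (U j) (U k) → Labeling edges (i , j , k)
  labeling-U {i} {j} {k} distinct (i≤j , j≤k , edges-ijk) =
    distinct , offset-mono i≤j , offset-mono j≤k , Pattern-cong (adj-U i j) (adj-U i k) (adj-U j k) (pattern-of edges-ijk)

  balanceable-U : ∀ {i j k} → Balanceable G (U i) (U j) (U k) → Balanceable₄ edges
  balanceable-U {i} {j} {k} (Ui≢Uj , Ui≢Uk , Uj≢Uk , labelings) = labeling labelings
    where
    i≢j : i ≢ j
    i≢j = Ui≢Uj ∘ cong U
    i≢k : i ≢ k
    i≢k = Ui≢Uk ∘ cong U
    j≢k : j ≢ k
    j≢k = Uj≢Uk ∘ cong U
    labeling : BalancedLabeling G (U i) (U j) (U k) ⊎ BalancedLabeling G (U i) (U k) (U j) ⊎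
               BalancedLabeling G (U j) (U i) (U k) ⊎ BalancedLabeling G (U j) (U k) (U i) ⊎
               BalancedLabeling G (U k) (U i) (U j) ⊎ BalancedLabeling G (U k) (U j) (U i) → Balanceable₄ edges
    labeling (inj₁ l)                             = (i , j , k) , labeling-U (i≢j , i≢k , j≢k) l
    labeling (inj₂ (inj₁ l))                      = (i , k , j) , labeling-U (i≢k , i≢j , ≢-sym j≢k) l
    labeling (inj₂ (inj₂ (inj₁ l)))               = (j , i , k) , labeling-U (≢-sym i≢j , j≢k , i≢k) l
    labeling (inj₂ (inj₂ (inj₂ (inj₁ l))))        = (j , k , i) , labeling-U (j≢k , ≢-sym i≢j , ≢-sym i≢k) l
    labeling (inj₂ (inj₂ (inj₂ (inj₂ (inj₁ l))))) = (k , i , j) , labeling-U (≢-sym i≢k , ≢-sym j≢k , i≢j) l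
    labeling (inj₂ (inj₂ (inj₂ (inj₂ (inj₂ l))))) = (k , j , i) , labeling-U (≢-sym j≢k , ≢-sym i≢k , ≢-sym i≢j) l

module _ (G : Graph n) {v₁ v₂ v₃ v₄ : Fin n}
         (v₁≢v₂ : v₁ ≢ v₂) (v₁≢v₃ : v₁ ≢ v₃) (v₁≢v₄ : v₁ ≢ v₄) (v₂≢v₃ : v₂ ≢ v₃) (v₂≢v₄ : v₂ ≢ v₄) (v₃≢v₄ : v₃ ≢ v₄)
         {d : ℕ} (deg₁ : deg G v₁ ≡ d) (deg₂ : deg G v₂ ≡ d) (deg₃ : deg G v₃ ≡ d + 2) (deg₄ : deg G v₄ ≡ d + 2) where

  private
    U : Fin 4 → Fin n
    U = lookup (v₁ ∷ v₂ ∷ v₃ ∷ v₄ ∷ [])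

    U-injective : ∀ {i j} → U i ≡ U j → i ≡ j
    U-injective {0F} {0F} _  = refl
    U-injective {0F} {1F} eq = ⊥-elim (v₁≢v₂ eq)
    U-injective {0F} {2F} eq = ⊥-elim (v₁≢v₃ eq)
    U-injective {0F} {3F} eq = ⊥-elim (v₁≢v₄ eq)
    U-injective {1F} {0F} eq = ⊥-elim (v₁≢v₂ (sym eq))
    U-injective {1F} {1F} _  = refl
    U-injective {1F} {2F} eq = ⊥-elim (v₂≢v₃ eq)
    U-injective {1F} {3F} eq = ⊥-elim (v₂≢v₄ eq)
    U-injective {2F} {0F} eq = ⊥-elim (v₁≢v₃ (sym eq))
    U-injective {2F} {1F} eq = ⊥-elim (v₂≢v₃ (sym eq))
    U-injective {2F} {2F} _  = refl
    U-injective {2F} {3F} eq = ⊥-elim (v₃≢v₄ eq)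
    U-injective {3F} {0F} eq = ⊥-elim (v₁≢v₄ (sym eq))
    U-injective {3F} {1F} eq = ⊥-elim (v₂≢v₄ (sym eq))
    U-injective {3F} {2F} eq = ⊥-elim (v₃≢v₄ (sym eq))
    U-injective {3F} {3F} _  = refl

    deg-U : ∀ i → deg G (U i) ≡ d + offset i
    deg-U 0F = trans deg₁ (sym (+-identityʳ d))
    deg-U 1F = trans deg₂ (sym (+-identityʳ d))
    deg-U 2F = deg₃
    deg-U 3F = deg₄

    index : ∀ {w} → w ∈₄ (v₁ , v₂ , v₃ , v₄) → ∃[ i ] w ≡ U i
    index (inj₁ refl)               = 0F , refl
    index (inj₂ (inj₁ refl))        = 1F , refl
    index (inj₂ (inj₂ (inj₁ refl))) = 2F , refl
    index (inj₂ (inj₂ (inj₂ refl))) = 3F , refl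

    open Quadruple G U U-injective d deg-U using (equal-degree-triple; balanceable-U)

  balanceable-quadruple : ∀ {a b c} → a ∈₄ (v₁ , v₂ , v₃ , v₄) → b ∈₄ (v₁ , v₂ , v₃ , v₄) → c ∈₄ (v₁ , v₂ , v₃ , v₄) →
                          Balanceable G a b c → EqualDegreeTripleAfterDeleting≤3 G
  balanceable-quadruple a∈ b∈ c∈ balanceable with index a∈ | index b∈ | index c∈
  ... | i , refl | j , refl | k , refl = equal-degree-triple (balanceable-U {i} {j} {k} balanceable)

lemma2p4 : (n : ℕ) (G : Graph n) (d : ℕ) → 1 ≤ d →
    (v₁ v₂ v₃ v₄ : Fin n) →
    v₁ ≢ v₂ → v₁ ≢ v₃ → v₁ ≢ v₄ → v₂ ≢ v₃ → v₂ ≢ v₄ → v₃ ≢ v₄ →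
    deg G v₁ ≡ d → deg G v₂ ≡ d → deg G v₃ ≡ d + 2 → deg G v₄ ≡ d + 2 →
    (∃[ x ] ∃[ y ] ∃[ z ] (x ∈₄ (v₁ , v₂ , v₃ , v₄)) × (y ∈₄ (v₁ , v₂ , v₃ , v₄))
        × (z ∈₄ (v₁ , v₂ , v₃ , v₄)) × Balanceable G x y z) →
    Σ[ D ∈ Subset n ] ∣ D ∣ ≤ 3 ×
      (∃[ a ] ∃[ b ] ∃[ c ] a ∉ D × b ∉ D × c ∉ D × a ≢ b × a ≢ c × b ≢ c
        × degDel G D a ≡ degDel G D b × degDel G D a ≡ degDel G D c)
lemma2p4 n G d _ v₁ v₂ v₃ v₄ v₁≢v₂ v₁≢v₃ v₁≢v₄ v₂≢v₃ v₂≢v₄ v₃≢v₄ deg₁ deg₂ deg₃ deg₄ (_ , _ , _ , x∈ , y∈ , z∈ , balanceable) =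
  balanceable-quadruple G v₁≢v₂ v₁≢v₃ v₁≢v₄ v₂≢v₃ v₂≢v₄ v₃≢v₄ deg₁ deg₂ deg₃ deg₄ x∈ y∈ z∈ balanceable
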